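{- Let $a<b$ be positive integers and let $q$ and $r$ be the quotient and remainder of $b$ divided by $a$. For $i=0,1,\ldots,a-1$ let $$S_i=\left\{\left\lceil \tfrac{bi}{a}\right\rceil,\left\lceil \tfrac{bi}{a}\right\rceil+1,\ldots,\left\lceil \tfrac{b(i+1)}{a}\right\rceil-1\right\},$$ so that $S_0,\ldots,S_{a-1}$ partition $\{0,1,\ldots,b-1\}$. Then $|S_i|=q+1$ whenever $i=\lfloor \frac{aj}{r}\rfloor$ for some $j\in\{0,1,\ldots,r-1\}$. -}

module Defs where

open import Data.Nat using (ℕ; zero; suc; _+_; _*_; _∸_; NonZero)
open import Data.Nat.DivMod using (_/_)
open import Data.List using (List; map; upTo)

ceilDiv : (m n : ℕ) → .{{NonZero n}} → ℕ
ceilDiv m n = (m + (n ∸ 1)) / n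

range : ℕ → ℕ → List ℕ
range lo hi = map (lo +_) (upTo (hi ∸ lo))

S : (a b : ℕ) → .{{NonZero a}} → ℕ → List ℕ
S a b i = range (ceilDiv (b * i) a) (ceilDiv (b * suc i) a)

-- Write b = q a + r with r < a and i = ⌊a j / r⌋, so that r i ≤ a j < r i + r.
-- Then ⌈b i / a⌉ = q i + ⌈r i / a⌉ = q i + j, and since the step from r i to
-- r (i + 1) is r ≤ a, also ⌈b (i + 1) / a⌉ = q (i + 1) + j + 1; the two ends
-- of S_i differ by q + 1.
module Submission where

open import Defs
open import Data.Nat using (ℕ; suc; _+_; _*_; _∸_; _<_; _≤_; NonZero)
open import Data.Nat.DivMod
open import Data.Nat.Divisibility using (divides-refl)
open import Data.Nat.Properties
open import Data.Nat.Tactic.RingSolver using (solve-∀)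
open import Data.List using (length; upTo)
open import Data.List.Properties using (length-map; length-upTo)
open import Relation.Binary.PropositionalEquality

length-range : ∀ lo hi → length (range lo hi) ≡ hi ∸ lo
length-range lo hi = trans (length-map (lo +_) (upTo (hi ∸ lo))) (length-upTo (hi ∸ lo))

m<[m/n]*n+n : ∀ m n .{{_ : NonZero n}} → m < m / n * n + n
m<[m/n]*n+n m n = begin-strict
  m                  ≡⟨ m≡m%n+[m/n]*n m n ⟩
  m % n + m / n * n  <⟨ +-monoˡ-< (m / n * n) (m%n<n m n) ⟩
  n + m / n * n      ≡⟨ +-comm n (m / n * n) ⟩
  m / n * n + n      ∎
  where open ≤-Reasoning

k*n≤m<k*n+n⇒m/n≡k : ∀ {m n k} .{{_ : NonZero n}} →
                     k * n ≤ m → m < k * n + n → m / n ≡ k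
k*n≤m<k*n+n⇒m/n≡k {m} {n} {k} k*n≤m m<k*n+n = ≤-antisym m/n≤k k≤m/n
  where
  m/n≤k : m / n ≤ k
  m/n≤k = m<1+n⇒m≤n (m<n*o⇒m/o<n (subst (m <_) (+-comm (k * n) n) m<k*n+n))
  k≤m/n : k ≤ m / n
  k≤m/n = subst (_≤ m / n) (m*n/n≡m k n) (/-monoˡ-≤ n k*n≤m)

m≤k*n<m+n⇒ceilDiv≡k : ∀ {m n k} .{{_ : NonZero n}} →
                       m ≤ k * n → k * n < m + n → ceilDiv m n ≡ k
m≤k*n<m+n⇒ceilDiv≡k {m} {n@(suc n-1)} {k} m≤k*n k*n<m+n = k*n≤m<k*n+n⇒m/n≡k lower upper
  where
  lower : k * n ≤ m + n-1
  lower = m<1+n⇒m≤n (subst (k * n <_) (+-suc m n-1) k*n<m+n)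
  upper : m + n-1 < k * n + n
  upper = +-mono-≤-< m≤k*n (n<1+n n-1)

ceilDiv-[k*n+m]≡k+ceilDiv-m : ∀ k m n .{{_ : NonZero n}} →
                              ceilDiv (k * n + m) n ≡ k + ceilDiv m n
ceilDiv-[k*n+m]≡k+ceilDiv-m k m n = begin
  (k * n + m + (n ∸ 1)) / n            ≡⟨ /-congˡ (+-assoc (k * n) m (n ∸ 1)) ⟩
  (k * n + (m + (n ∸ 1))) / n          ≡⟨ +-distrib-/-∣ˡ (m + (n ∸ 1)) (divides-refl k) ⟩
  k * n / n + (m + (n ∸ 1)) / n        ≡⟨ cong (_+ ceilDiv m n) (m*n/n≡m k n) ⟩
  k + ceilDiv m n                      ∎
  where open ≡-Reasoning

module _ {a r i j : ℕ} .{{_ : NonZero a}}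
         (r≤a : r ≤ a) (lower : i * r ≤ a * j) (upper : a * j < i * r + r) where

  ceilDiv-[r*i]≡j : ceilDiv (r * i) a ≡ j
  ceilDiv-[r*i]≡j = m≤k*n<m+n⇒ceilDiv≡k
    (subst₂ _≤_ (*-comm i r) (*-comm a j) lower)
    (subst₂ _<_ (*-comm a j) (cong (_+ a) (*-comm i r)) (<-≤-trans upper (+-monoʳ-≤ (i * r) r≤a)))

  ceilDiv-[r*suc-i]≡suc-j : ceilDiv (r * suc i) a ≡ suc j
  ceilDiv-[r*suc-i]≡suc-j = m≤k*n<m+n⇒ceilDiv≡k
    (subst₂ _≤_ i*r+r≡r*suc-i (+-comm (j * a) a)
      (+-mono-≤ (subst (i * r ≤_) (*-comm a j) lower) r≤a))
    (subst₂ _<_ (+-comm (j * a) a) (cong (_+ a) i*r+r≡r*suc-i)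
      (+-monoˡ-< a (subst (_< i * r + r) (*-comm a j) upper)))
    where
    i*r+r≡r*suc-i : i * r + r ≡ r * suc i
    i*r+r≡r*suc-i = trans (+-comm (i * r) r) (trans (cong (r +_) (*-comm i r)) (sym (*-suc r i)))

lemma2p3 : (a b : ℕ) → .{{_ : NonZero a}} → a < b →
    (q r : ℕ) → q ≡ b / a → r ≡ b % a →
    .{{_ : NonZero r}} → (j : ℕ) → j < r →
    length (S a b ((a * j) / r)) ≡ suc q
lemma2p3 a b _ q r refl refl j _ = begin
  length (S a b i)
    ≡⟨ length-range (ceilDiv (b * i) a) (ceilDiv (b * suc i) a) ⟩
  ceilDiv (b * suc i) a ∸ ceilDiv (b * i) a
    ≡⟨ cong₂ _∸_ (ceilDiv-[b*x] (suc i)) (ceilDiv-[b*x] i) ⟩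
  (q * suc i + ceilDiv (r * suc i) a) ∸ (q * i + ceilDiv (r * i) a)
    ≡⟨ cong₂ (λ hi lo → (q * suc i + hi) ∸ (q * i + lo))
             (ceilDiv-[r*suc-i]≡suc-j r≤a lower upper) (ceilDiv-[r*i]≡j r≤a lower upper) ⟩
  (q * suc i + suc j) ∸ (q * i + j)                  ≡⟨ cong (_∸ (q * i + j)) (hi≡lo+suc-q q i j) ⟩
  (q * i + j) + suc q ∸ (q * i + j)                  ≡⟨ m+n∸m≡n (q * i + j) (suc q) ⟩
  suc q                                              ∎
  where
  open ≡-Reasoning
  i : ℕ
  i = a * j / r
  r≤a : r ≤ a
  r≤a = <⇒≤ (m%n<n b a)
  lower : i * r ≤ a * j
  lower = m/n*n≤m (a * j) r
  upper : a * j < i * r + r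
  upper = m<[m/n]*n+n (a * j) r
  b*x≡q*x*a+r*x : ∀ x → b * x ≡ q * x * a + r * x
  b*x≡q*x*a+r*x x = trans (cong (_* x) (m≡m%n+[m/n]*n b a)) (expand r q a x)
    where
    expand : ∀ r q a x → (r + q * a) * x ≡ q * x * a + r * x
    expand = solve-∀
  ceilDiv-[b*x] : ∀ x → ceilDiv (b * x) a ≡ q * x + ceilDiv (r * x) a
  ceilDiv-[b*x] x = trans (cong (λ m → ceilDiv m a) (b*x≡q*x*a+r*x x))
                          (ceilDiv-[k*n+m]≡k+ceilDiv-m (q * x) (r * x) a)
  hi≡lo+suc-q : ∀ q i j → q * suc i + suc j ≡ (q * i + j) + suc q
  hi≡lo+suc-q = solve-∀
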